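{- Let $n,k$ be positive integers, let $\chi$ be a riwi-map on $\mathcal{F}'_{n,k}$, let $q=n/\gcd(n,k)$, and for each neck-class of $\mathcal{F}'_{n,k,0}$ fix an arbitrary representative $f$. Define $\sigma_\chi:\mathcal{F}'_{n,k,0}\to\mathcal{N}'_{n,k}$ by $\sigma_\chi(c^{iq}(f))=\nu(\chi^i(f))$ for each chosen representative $f$ and each $0\le i<n/q$. Then $\sigma_\chi$ is a bijection between $\mathcal{F}'_{n,k,0}$ and $\mathcal{N}'_{n,k}$.
   Context: An $(n,k)$-code is a function $f:\mathbb{Z}_n\to\mathbb{Z}_{\ge 0}$ (positions indexed cyclically, written $f=(f_0,\dots,f_{n-1})$) with $\sum_i f_i=k$. For $t\in\mathbb{Z}_n$, $\mathcal{F}_{n,k,t}$ is the set of $(n,k)$-codes with $\sum_i i f_i\equiv t\pmod n$. The rotation map is $c(f_0,\dots,f_{n-1})=(f_1,\dots,f_{n-1},f_0)$. The period of a code $f$ is the least $p\ge1$ with $c^p(f)=f$. $\mathcal{F}'_{n,k,t}$ is the set of codes in $\mathcal{F}_{n,k,t}$ of period $n$, and $\mathcal{F}'_{n,k}=\bigcup_t\mathcal{F}'_{n,k,t}$. $\mathcal{N}_{n,k}$ is the set of binary necklaces (cyclic words up to rotation) of length $n+k$ with $n$ black beads and $k$ white beads. To a code $f$ associate the necklace $\nu(f)$ given by the cyclic word $B W^{f_0} B W^{f_1}\cdots B W^{f_{n-1}}$ (so $f_i$ counts the white beads between the $i$-th and $(i+1)$-st black bead); $\nu(f)=\nu(g)$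 iff $g=c^j(f)$ for some $j$, and every necklace is $\nu(f)$ for some code $f$. $\mathcal{N}'_{n,k}$ is the set of necklaces $\nu(f)$ with $f$ of period $n$. With $q=n/\gcd(n,k)$, for $f\in\mathcal{F}_{n,k,t}$ the neck-class of $f$ is $\{f,c^q(f),c^{2q}(f),\dots,c^{n-q}(f)\}$ (these are exactly the codes in $\mathcal{F}_{n,k,t}$ rotation-equivalent to $f$). A riwi-map is a map $\chi:\mathcal{F}'_{n,k}\to\mathcal{F}'_{n,k}$ that is bijective, satisfies $c\chi=\chi c$, and maps $\mathcal{F}'_{n,k,t}$ into $\mathcal{F}'_{n,k,t+1}$ for every $t\in\mathbb{Z}_n$. -}

module Defs where

open import Data.Nat using (ℕ; zero; suc; _+_; _*_; _≤_; _<_; _%_; NonZero)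
open import Data.Nat.GCD using (gcd)
open import Data.Vec using (Vec; []; _∷_; _∷ʳ_; sum)
open import Data.List using (List; []; _∷_; _++_; replicate)
open import Data.Bool using (Bool; true; false)
open import Data.Product using (Σ; _×_; ∃; ∃-syntax)
open import Relation.Binary.PropositionalEquality using (_≡_; _≢_)
open import Relation.Nullary using (¬_)

-- An (n,k)-code is represented as a vector (f_0, …, f_{n-1}) of naturals;
-- the condition Σ f_i = k is part of the membership predicates below.
Code : ℕ → Set
Code n = Vec ℕ n

iter : ∀ {A : Set} → ℕ → (A → A) → A → A
iter zero    g x = x
iter (suc p) g x = g (iter p g x)

rot : ∀ {n} → Code n → Code n
rot []       = []
rot (x ∷ xs) = xs ∷ʳ x

wsumFrom : ∀ {n} → ℕ → Code n → ℕ
wsumFrom s []       = 0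
wsumFrom s (x ∷ xs) = s * x + wsumFrom (suc s) xs

wsum : ∀ {n} → Code n → ℕ
wsum = wsumFrom 0

IsPeriod : ∀ {n} → Code n → ℕ → Set
IsPeriod f p = (1 ≤ p) × (iter p rot f ≡ f)
             × (∀ p′ → 1 ≤ p′ → p′ < p → iter p′ rot f ≢ f)

InF′ : (n k : ℕ) → Code n → Set
InF′ n k f = (sum f ≡ k) × IsPeriod f n

InF′t : (n k : ℕ) .{{_ : NonZero n}} → ℕ → Code n → Set
InF′t n k t f = InF′ n k f × (wsum f % n ≡ t % n)

-- riwi-map: χ given as a function on all codes, with all requirements
-- imposed on F'_{n,k} (its values outside F'_{n,k} are irrelevant).
record IsRiwi (n k : ℕ) .{{_ : NonZero n}} (χ : Code n → Code n) : Set where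
  field
    maps-into  : ∀ f → InF′ n k f → InF′ n k (χ f)
    injective  : ∀ f g → InF′ n k f → InF′ n k g → χ f ≡ χ g → f ≡ g
    surjective : ∀ g → InF′ n k g → ∃[ f ] (InF′ n k f × χ f ≡ g)
    commutes   : ∀ f → InF′ n k f → χ (rot f) ≡ rot (χ f)
    shifts-t   : ∀ t f → InF′t n k t f → InF′t n k (suc t) (χ f)

-- Binary words: true = black bead B, false = white bead W.
Word : Set
Word = List Bool

-- ν(f) = B W^{f_0} B W^{f_1} ⋯ B W^{f_{n-1}}  (as a linear word; the
-- necklace is its class under word rotation, see NeckEq)
ν : ∀ {n} → Code n → Word
ν []       = []
ν (x ∷ xs) = (true ∷ replicate x false) ++ ν xs

rotW : Word → Word
rotW []       = []
rotW (x ∷ xs) = xs ++ (x ∷ [])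

NeckEq : Word → Word → Set
NeckEq w w′ = ∃[ j ] (iter j rotW w ≡ w′)

InN′ : (n k : ℕ) → Word → Set
InN′ n k w = ∃[ g ] (InF′ n k g × NeckEq (ν g) w)

SameNeckClass : ∀ {n} → ℕ → Code n → Code n → Set
SameNeckClass q x y = ∃[ j ] (iter (j * q) rot x ≡ y)

record IsRepChoice (n k q : ℕ) .{{_ : NonZero n}} (rep : Code n → Code n) : Set where
  field
    rep-in    : ∀ x → InF′t n k 0 x → InF′t n k 0 (rep x)
    rep-class : ∀ x → InF′t n k 0 x → SameNeckClass q (rep x) x
    rep-const : ∀ x y → InF′t n k 0 x → InF′t n k 0 y →
                SameNeckClass q x y → rep x ≡ rep y

IsSigma : (n k q : ℕ) .{{_ : NonZero n}} → (Code n → Code n) → (Code n → Code n)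
          → (Code n → Word) → Set
IsSigma n k q χ rep σ =
  ∀ x i → InF′t n k 0 x → i < gcd n k → iter (i * q) rot (rep x) ≡ x →
  σ x ≡ ν (iter i χ (rep x))

module Submission where

open import Defs
open import Data.Nat using (ℕ; _*_; _<_; NonZero)
open import Data.Nat.GCD using (gcd)
open import Data.Product using (_×_; ∃-syntax)
open import Relation.Binary.PropositionalEquality using (_≡_)

open import Data.Bool using (Bool; true; false)
open import Data.Empty using (⊥-elim)
open import Data.List using ([]; _∷_; _++_; replicate; length)
open import Data.List.Properties using (++-assoc; ++-identityʳ; length-replicate; ∷-injectiveʳ)
open import Data.Nat using (zero; suc; _+_; _≤_; _%_; _/_; z≤n; s≤s; _≟_; ≢-nonZero)
open import Data.Nat.Coprimality using (Coprime; coprime-/gcd; coprime-divisor)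
open import Data.Nat.Divisibility using (_∣_; divides; ∣-trans; n∣m*n; *-cancelʳ-∣; m%n≡0⇒n∣m)
open import Data.Nat.DivMod
  using (m≡m%n+[m/n]*n; m%n<n; m<n⇒m%n≡m; [m+kn]%n≡m%n; %-distribˡ-+; %-distribˡ-*; %-remove-+ʳ; m∣n⇒o%n%m≡o%m; m/n*n≡m; m*n/n≡m)
open import Data.Nat.GCD using (gcd[m,n]∣m; gcd[m,n]∣n; gcd[m,n]≢0; gcd-GCD; module Bézout)
open import Data.Nat.Properties using (+-comm; +-assoc; +-identityʳ; *-assoc; *-comm; ≤∧≢⇒<)
open import Data.Nat.Tactic.RingSolver using (solve-∀)
open import Data.Product using (_,_; proj₁; proj₂)
open import Data.Sum using (inj₁)
open import Data.Vec using ([]; _∷_; _∷ʳ_; sum; head)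
open import Data.Vec.Properties using (∷ʳ-injective)
open import Relation.Nullary using (¬_; yes; no)
open import Relation.Binary.PropositionalEquality using (refl; sym; trans; cong; cong₂; subst; subst₂; module ≡-Reasoning)

-- Rotating a code by m lowers its weight Σ i·f_i by m·k modulo n, and ν f, ν g
-- are the same necklace exactly when g is a rotation of f.  Hence a necklace
-- determines the weight of its codes modulo G = gcd(n,k), and two weight-0 codes
-- that are rotations of each other differ by a rotation through a multiple of q.
-- As χ commutes with rotation and raises the weight by one, ν(χ^i f) for
-- 0 ≤ i < G recovers i (as the weight modulo G) and the neck-class of f.
-- Conversely, by Bézout every necklace has a code of weight i < G, which is χ^i
-- of a weight-0 code.

module _ {A : Set} where

  iter-+ : ∀ a b (g : A → A) x → iter (a + b) g x ≡ iter a g (iter b g x)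
  iter-+ zero    b g x = refl
  iter-+ (suc a) b g x = cong g (iter-+ a b g x)

  iter-sucʳ : ∀ p (g : A → A) x → iter (suc p) g x ≡ iter p g (g x)
  iter-sucʳ zero    g x = refl
  iter-sucʳ (suc p) g x = cong g (iter-sucʳ p g x)

  iter-*-fixed : ∀ {p} (g : A → A) {x} → iter p g x ≡ x → ∀ z → iter (z * p) g x ≡ x
  iter-*-fixed         g     fix zero    = refl
  iter-*-fixed {p} g {x} fix (suc z) = begin
    iter (p + z * p) g x         ≡⟨ iter-+ p (z * p) g x ⟩
    iter p g (iter (z * p) g x)  ≡⟨ cong (iter p g) (iter-*-fixed g fix z) ⟩
    iter p g x                   ≡⟨ fix ⟩
    x                            ∎
    where open ≡-Reasoning

  module _ (P : A → Set) where

    iter-preserves : (g : A → A) → (∀ x → P x → P (g x)) → ∀ m x → P x → P (iter m g x)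
    iter-preserves g pres zero    x px = px
    iter-preserves g pres (suc m) x px = pres _ (iter-preserves g pres m x px)

    iter-injectiveOn : (g : A → A) → (∀ x → P x → P (g x)) →
                       (∀ x y → P x → P y → g x ≡ g y → x ≡ y) →
                       ∀ m x y → P x → P y → iter m g x ≡ iter m g y → x ≡ y
    iter-injectiveOn g pres inj zero    x y px py e = e
    iter-injectiveOn g pres inj (suc m) x y px py e =
      iter-injectiveOn g pres inj m x y px py
        (inj _ _ (iter-preserves g pres m x px) (iter-preserves g pres m y py) e)

    iter-surjectiveOn : (g : A → A) → (∀ y → P y → ∃[ x ] (P x × g x ≡ y)) →
                        ∀ m y → P y → ∃[ x ] (P x × iter m g x ≡ y)
    iter-surjectiveOn g surj zero y py = y , py , refl
    iter-surjectiveOn g surj (suc m) y py with surj y py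
    ... | z , pz , refl with iter-surjectiveOn g surj m z pz
    ...   | x , px , refl = x , px , refl

    iter-commutesOn : (g h : A → A) → (∀ x → P x → P (g x)) → (∀ x → P x → P (h x)) →
                      (∀ x → P x → g (h x) ≡ h (g x)) →
                      ∀ i m x → P x → iter i g (iter m h x) ≡ iter m h (iter i g x)
    iter-commutesOn g h g-pres h-pres comm zero    m x px = refl
    iter-commutesOn g h g-pres h-pres comm (suc i) m x px =
      trans (cong g (iter-commutesOn g h g-pres h-pres comm i m x px))
            (g-commutes m (iter i g x) (iter-preserves g g-pres i x px))
      where
      g-commutes : ∀ m y → P y → g (iter m h y) ≡ iter m h (g y)
      g-commutes zero    y py = refl
      g-commutes (suc m) y py =
        trans (comm _ (iter-preserves h h-pres m y py)) (cong h (g-commutes m y py))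

iter-rotW-++ : ∀ (xs ys : Word) → iter (length xs) rotW (xs ++ ys) ≡ ys ++ xs
iter-rotW-++ []       ys = sym (++-identityʳ ys)
iter-rotW-++ (x ∷ xs) ys = begin
  iter (suc (length xs)) rotW (x ∷ xs ++ ys)     ≡⟨ iter-sucʳ (length xs) rotW _ ⟩
  iter (length xs) rotW ((xs ++ ys) ++ x ∷ [])   ≡⟨ cong (iter (length xs) rotW) (++-assoc xs ys (x ∷ [])) ⟩
  iter (length xs) rotW (xs ++ (ys ++ x ∷ []))   ≡⟨ iter-rotW-++ xs (ys ++ x ∷ []) ⟩
  (ys ++ x ∷ []) ++ xs                           ≡⟨ ++-assoc ys (x ∷ []) xs ⟩
  ys ++ x ∷ xs                                   ∎
  where open ≡-Reasoning

iter-rotW-replicate : ∀ (c : Bool) s x zs → s < x →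
                      ∃[ r ] iter s rotW (replicate x c ++ zs) ≡ c ∷ r
iter-rotW-replicate c zero    (suc x) zs _ = _ , refl
iter-rotW-replicate c (suc s) (suc x) zs (s≤s s<x)
  with iter-rotW-replicate c s x (zs ++ c ∷ []) s<x
... | r , e = r , (begin
  iter (suc s) rotW (c ∷ replicate x c ++ zs)     ≡⟨ iter-sucʳ s rotW _ ⟩
  iter s rotW ((replicate x c ++ zs) ++ c ∷ [])   ≡⟨ cong (iter s rotW) (++-assoc (replicate x c) zs (c ∷ [])) ⟩
  iter s rotW (replicate x c ++ (zs ++ c ∷ []))   ≡⟨ e ⟩
  c ∷ r                                           ∎)
  where open ≡-Reasoning

NeckEq-reflexive : ∀ {w w′} → w ≡ w′ → NeckEq w w′
NeckEq-reflexive e = 0 , e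

NeckEq-trans : ∀ {u v w} → NeckEq u v → NeckEq v w → NeckEq u w
NeckEq-trans {u} (j , e) (j′ , e′) =
  j′ + j , trans (iter-+ j′ j rotW u) (trans (cong (iter j′ rotW) e) e′)

ν-∷ʳ : ∀ {n} (xs : Code n) x → ν (xs ∷ʳ x) ≡ ν xs ++ true ∷ replicate x false
ν-∷ʳ []       x = ++-identityʳ _
ν-∷ʳ (y ∷ xs) x =
  trans (cong ((true ∷ replicate y false) ++_) (ν-∷ʳ xs x))
        (sym (++-assoc (true ∷ replicate y false) (ν xs) _))

ν-rot : ∀ {n} (f : Code (suc n)) → iter (suc (head f)) rotW (ν f) ≡ ν (rot f)
ν-rot (x ∷ xs) = begin
  iter (suc x) rotW (ν (x ∷ xs))
    ≡⟨ cong (λ l → iter (suc l) rotW (ν (x ∷ xs))) (sym (length-replicate x)) ⟩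
  iter (length (true ∷ replicate x false)) rotW ((true ∷ replicate x false) ++ ν xs)
    ≡⟨ iter-rotW-++ (true ∷ replicate x false) (ν xs) ⟩
  ν xs ++ true ∷ replicate x false
    ≡⟨ sym (ν-∷ʳ xs x) ⟩
  ν (xs ∷ʳ x) ∎
  where open ≡-Reasoning

ν-NeckEq-iter-rot : ∀ {n} (f : Code (suc n)) m → NeckEq (ν f) (ν (iter m rot f))
ν-NeckEq-iter-rot f zero    = NeckEq-reflexive refl
ν-NeckEq-iter-rot f (suc m) =
  NeckEq-trans (ν-NeckEq-iter-rot f m) (suc (head (iter m rot f)) , ν-rot (iter m rot f))

replicate-false-++-ν-injective : ∀ {n} x y (f g : Code n) →
  replicate x false ++ ν f ≡ replicate y false ++ ν g → x ≡ y × ν f ≡ ν g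
replicate-false-++-ν-injective zero    zero    f       g       e  = refl , e
replicate-false-++-ν-injective zero    (suc y) []      []      ()
replicate-false-++-ν-injective zero    (suc y) (_ ∷ _) _       ()
replicate-false-++-ν-injective (suc x) zero    []      []      ()
replicate-false-++-ν-injective (suc x) zero    _       (_ ∷ _) ()
replicate-false-++-ν-injective (suc x) (suc y) f       g       e
  with replicate-false-++-ν-injective x y f g (∷-injectiveʳ e)
... | refl , e′ = refl , e′

ν-injective : ∀ {n} {f g : Code n} → ν f ≡ ν g → f ≡ g
ν-injective {f = []}    {[]}    _ = refl
ν-injective {f = x ∷ f} {y ∷ g} e
  with replicate-false-++-ν-injective x y f g (∷-injectiveʳ e)
... | refl , e′ = cong (x ∷_) (ν-injective e′)

iter-rotW-ν-split : ∀ {n} (f : Code (suc n)) j →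
  ∃[ m ] ∃[ s ] s ≤ head (iter m rot f) × iter j rotW (ν f) ≡ iter s rotW (ν (iter m rot f))
iter-rotW-ν-split f zero = 0 , 0 , z≤n , refl
iter-rotW-ν-split f (suc j) with iter-rotW-ν-split f j
... | m , s , s≤h , e with s ≟ head (iter m rot f)
...   | yes refl = suc m , 0 , z≤n , trans (cong rotW e) (ν-rot (iter m rot f))
...   | no s≢h   = m , suc s , ≤∧≢⇒< s≤h s≢h , cong rotW e

iter-rotW-ν-white : ∀ {n} (f : Code (suc n)) s → s < head f →
                    ∃[ r ] iter (suc s) rotW (ν f) ≡ false ∷ r
iter-rotW-ν-white (x ∷ xs) s s<x
  with iter-rotW-replicate false s x (ν xs ++ true ∷ []) s<x
... | r , e = r , (begin
  iter (suc s) rotW (true ∷ replicate x false ++ ν xs)     ≡⟨ iter-sucʳ s rotW _ ⟩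
  iter s rotW ((replicate x false ++ ν xs) ++ true ∷ [])   ≡⟨ cong (iter s rotW) (++-assoc (replicate x false) (ν xs) _) ⟩
  iter s rotW (replicate x false ++ ν xs ++ true ∷ [])     ≡⟨ e ⟩
  false ∷ r                                                ∎)
  where open ≡-Reasoning

-- A rotation of ν f that starts with a black bead is one of the words ν (c^m f).
NeckEq-ν⇒iter-rot : ∀ {n} (f g : Code (suc n)) → NeckEq (ν f) (ν g) → ∃[ m ] iter m rot f ≡ g
NeckEq-ν⇒iter-rot f g (j , e) with iter-rotW-ν-split f j
... | m , zero  , _   , e′ = m , ν-injective (trans (sym e′) e)
... | m , suc s , s<h , e′ with iter-rotW-ν-white (iter m rot f) s s<h | g
...   | r , e″ | x ∷ g′ with trans (sym e″) (trans (sym e′) e)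
...     | ()

sum-∷ʳ : ∀ {n} (xs : Code n) x → sum (xs ∷ʳ x) ≡ sum xs + x
sum-∷ʳ []       x = +-comm x 0
sum-∷ʳ (y ∷ xs) x = trans (cong (y +_) (sum-∷ʳ xs x)) (sym (+-assoc y _ x))

sum-rot : ∀ {n} (f : Code n) → sum (rot f) ≡ sum f
sum-rot []       = refl
sum-rot (x ∷ xs) = trans (sum-∷ʳ xs x) (+-comm _ x)

sum-iter-rot : ∀ {n} m (f : Code n) → sum (iter m rot f) ≡ sum f
sum-iter-rot m f = iter-preserves (λ g → sum g ≡ sum f) rot (λ g e → trans (sum-rot g) e) m f refl

wsumFrom-suc : ∀ {n} s (xs : Code n) → wsumFrom (suc s) xs ≡ wsumFrom s xs + sum xs
wsumFrom-suc s []       = refl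
wsumFrom-suc s (x ∷ xs) =
  trans (cong (suc s * x +_) (wsumFrom-suc (suc s) xs)) (ring s x (wsumFrom (suc s) xs) (sum xs))
  where
  ring : ∀ s x w t → suc s * x + (w + t) ≡ s * x + w + (x + t)
  ring = solve-∀

wsumFrom-∷ʳ : ∀ {n} s (xs : Code n) x → wsumFrom s (xs ∷ʳ x) ≡ wsumFrom s xs + (s + n) * x
wsumFrom-∷ʳ s []       x = trans (+-identityʳ (s * x)) (cong (_* x) (sym (+-identityʳ s)))
wsumFrom-∷ʳ {suc n} s (y ∷ xs) x =
  trans (cong (s * y +_) (wsumFrom-∷ʳ (suc s) xs x)) (ring s y (wsumFrom (suc s) xs) n x)
  where
  ring : ∀ s y w n x → s * y + (w + (suc s + n) * x) ≡ s * y + w + (s + suc n) * x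
  ring = solve-∀

wsum-rot : ∀ {n} (f : Code (suc n)) → wsum (rot f) + sum f ≡ wsum f + suc n * head f
wsum-rot {n} (x ∷ xs) = begin
  wsum (xs ∷ʳ x) + (x + sum xs)                  ≡⟨ cong (_+ (x + sum xs)) (wsumFrom-∷ʳ 0 xs x) ⟩
  wsumFrom 0 xs + n * x + (x + sum xs)           ≡⟨ ring (wsumFrom 0 xs) n x (sum xs) ⟩
  0 * x + (wsumFrom 0 xs + sum xs) + suc n * x   ≡⟨ cong (λ w → 0 * x + w + suc n * x) (sym (wsumFrom-suc 0 xs)) ⟩
  0 * x + wsumFrom 1 xs + suc n * x              ∎
  where
  open ≡-Reasoning
  ring : ∀ w n x t → w + n * x + (x + t) ≡ 0 * x + (w + t) + suc n * x
  ring = solve-∀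

wsum-iter-rot : ∀ {n k} m (f : Code (suc n)) → sum f ≡ k →
                (wsum (iter m rot f) + m * k) % suc n ≡ wsum f % suc n
wsum-iter-rot         zero    f sum≡k = cong (_% _) (+-identityʳ (wsum f))
wsum-iter-rot {n} {k} (suc m) f sum≡k = begin
  (wsum (rot g) + suc m * k) % suc n               ≡⟨ cong (_% suc n) step ⟩
  (wsum g + m * k + head g * suc n) % suc n        ≡⟨ [m+kn]%n≡m%n (wsum g + m * k) (head g) (suc n) ⟩
  (wsum g + m * k) % suc n                         ≡⟨ wsum-iter-rot m f sum≡k ⟩
  wsum f % suc n                                   ∎
  where
  open ≡-Reasoning
  g = iter m rot f
  ring₁ : ∀ w k m → w + suc m * k ≡ (w + k) + m * k
  ring₁ = solve-∀
  ring₂ : ∀ w n h mk → w + suc n * h + mk ≡ w + mk + h * suc n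
  ring₂ = solve-∀
  step : wsum (rot g) + suc m * k ≡ wsum g + m * k + head g * suc n
  step = begin
    wsum (rot g) + suc m * k           ≡⟨ ring₁ (wsum (rot g)) k m ⟩
    wsum (rot g) + k + m * k           ≡⟨ cong (λ s → wsum (rot g) + s + m * k) (sym (trans (sum-iter-rot m f) sum≡k)) ⟩
    wsum (rot g) + sum g + m * k       ≡⟨ cong (_+ m * k) (wsum-rot g) ⟩
    wsum g + suc n * head g + m * k    ≡⟨ ring₂ (wsum g) n (head g) (m * k) ⟩
    wsum g + m * k + head g * suc n    ∎

rot-injective : ∀ {n} {f g : Code n} → rot f ≡ rot g → f ≡ g
rot-injective {f = []}    {[]}    _ = refl
rot-injective {f = x ∷ f} {y ∷ g} e with ∷ʳ-injective f g e
... | refl , refl = refl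

rot-preserves-InF′ : ∀ {n k} f → InF′ n k f → InF′ n k (rot f)
rot-preserves-InF′ {n} f (sum≡k , 1≤n , fixed , least) =
  trans (sum-rot f) sum≡k , 1≤n , trans (sym (iter-sucʳ n rot f)) (cong rot fixed) ,
  λ p 1≤p p<n e → least p 1≤p p<n (rot-injective (trans (iter-sucʳ p rot f) e))

iter-rot-preserves-InF′ : ∀ {n k} m f → InF′ n k f → InF′ n k (iter m rot f)
iter-rot-preserves-InF′ {n} {k} = iter-preserves (InF′ n k) rot rot-preserves-InF′

iter-rot-*n : ∀ {n k} z f → InF′ n k f → iter (z * n) rot f ≡ f
iter-rot-*n z f (_ , _ , fixed , _) = iter-*-fixed rot fixed z

InF′-zero : ∀ {k} (f : Code 0) → ¬ InF′ 0 k f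
InF′-zero f (_ , () , _)

ν-NeckEq-iter-rot⁻¹ : ∀ {n k} m (f : Code (suc n)) → InF′ (suc n) k f →
                      NeckEq (ν (iter m rot f)) (ν f)
ν-NeckEq-iter-rot⁻¹ {n} m f f∈F′ =
  NeckEq-trans (ν-NeckEq-iter-rot (iter m rot f) (m * n)) (NeckEq-reflexive (cong ν back))
  where
  open ≡-Reasoning
  ring : ∀ m n → m * n + m ≡ m * suc n
  ring = solve-∀
  back : iter (m * n) rot (iter m rot f) ≡ f
  back = begin
    iter (m * n) rot (iter m rot f)   ≡⟨ iter-+ (m * n) m rot f ⟨
    iter (m * n + m) rot f            ≡⟨ cong (λ p → iter p rot f) (ring m n) ⟩
    iter (m * suc n) rot f            ≡⟨ iter-rot-*n m f f∈F′ ⟩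
    f                                 ∎

%-+-cong : ∀ {a a′ b b′ n} .{{_ : NonZero n}} →
           a % n ≡ a′ % n → b % n ≡ b′ % n → (a + b) % n ≡ (a′ + b′) % n
%-+-cong {a} {a′} {b} {b′} {n} ea eb = begin
  (a + b) % n              ≡⟨ %-distribˡ-+ a b n ⟩
  (a % n + b % n) % n      ≡⟨ cong₂ (λ x y → (x + y) % n) ea eb ⟩
  (a′ % n + b′ % n) % n    ≡⟨ %-distribˡ-+ a′ b′ n ⟨
  (a′ + b′) % n            ∎
  where open ≡-Reasoning

%-*-congˡ : ∀ a {b b′ n} .{{_ : NonZero n}} → b % n ≡ b′ % n → (a * b) % n ≡ (a * b′) % n
%-*-congˡ a {b} {b′} {n} eb = begin
  (a * b) % n              ≡⟨ %-distribˡ-* a b n ⟩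
  (a % n * (b % n)) % n    ≡⟨ cong (λ y → (a % n * y) % n) eb ⟩
  (a % n * (b′ % n)) % n   ≡⟨ %-distribˡ-* a b′ n ⟨
  (a * b′) % n             ∎
  where open ≡-Reasoning

%-+-cancelˡ : ∀ a {b c n} → (a + b) % suc n ≡ (a + c) % suc n → b % suc n ≡ c % suc n
%-+-cancelˡ a {b} {c} {n} e = begin
  b % suc n                  ≡⟨ [m+kn]%n≡m%n b a (suc n) ⟨
  (b + a * suc n) % suc n    ≡⟨ cong (_% suc n) (ring b a n) ⟩
  (a + b + a * n) % suc n    ≡⟨ %-+-cong {a + b} {a + c} {a * n} {a * n} e refl ⟩
  (a + c + a * n) % suc n    ≡⟨ cong (_% suc n) (ring c a n) ⟨
  (c + a * suc n) % suc n    ≡⟨ [m+kn]%n≡m%n c a (suc n) ⟩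
  c % suc n                  ∎
  where
  open ≡-Reasoning
  ring : ∀ b a n → b + a * suc n ≡ a + b + a * n
  ring = solve-∀

%-+-cancelʳ : ∀ c {a b n} → (a + c) % suc n ≡ (b + c) % suc n → a % suc n ≡ b % suc n
%-+-cancelʳ c {a} {b} {n} e = %-+-cancelˡ c (subst₂ (λ x y → x % suc n ≡ y % suc n) (+-comm a c) (+-comm b c) e)

module GcdArithmetic (n′ k : ℕ) where

  private
    n = suc n′
    G = gcd n k

  instance
    gcd-nonZero : NonZero G
    gcd-nonZero = ≢-nonZero (gcd[m,n]≢0 n k (inj₁ λ ()))

  n∣q*k : ∀ q → q * G ≡ n → n ∣ q * k
  n∣q*k q q*G≡n = divides (k / G) (begin
    q * k              ≡⟨ cong (q *_) (m/n*n≡m (gcd[m,n]∣n n k)) ⟨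
    q * (k / G * G)    ≡⟨ ring q (k / G) G ⟩
    k / G * (q * G)    ≡⟨ cong (k / G *_) q*G≡n ⟩
    k / G * n          ∎)
    where
    open ≡-Reasoning
    ring : ∀ q k′ G → q * (k′ * G) ≡ k′ * (q * G)
    ring = solve-∀

  n∣m*k⇒q∣m : ∀ q m → q * G ≡ n → n ∣ m * k → q ∣ m
  n∣m*k⇒q∣m q m q*G≡n n∣mk = coprime-divisor q⊥k/G (subst (q ∣_) (*-comm m (k / G)) q∣m*k/G)
    where
    q≡n/G : q ≡ n / G
    q≡n/G = trans (sym (m*n/n≡m q G)) (cong (_/ G) q*G≡n)
    q⊥k/G : Coprime q (k / G)
    q⊥k/G = subst (λ d → Coprime d (k / G)) (sym q≡n/G) (coprime-/gcd n k)
    q*G∣m*k/G*G : q * G ∣ m * (k / G) * G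
    q*G∣m*k/G*G = subst₂ _∣_ (sym q*G≡n)
      (trans (cong (m *_) (sym (m/n*n≡m (gcd[m,n]∣n n k)))) (sym (*-assoc m (k / G) G))) n∣mk
    q∣m*k/G : q ∣ m * (k / G)
    q∣m*k/G = *-cancelʳ-∣ G q*G∣m*k/G*G

  gcd≡multiple-of-k : ∃[ m ] (m * k) % n ≡ G % n
  gcd≡multiple-of-k with Bézout.identity (gcd-GCD n k)
  ... | Bézout.-+ x y eq = y , (begin
    (y * k) % n          ≡⟨ cong (_% n) eq ⟨
    (G + x * n) % n      ≡⟨ [m+kn]%n≡m%n G x n ⟩
    G % n                ∎)
    where open ≡-Reasoning
  ... | Bézout.+- x y eq = y * n′ , (begin
    (y * n′ * k) % n                 ≡⟨ [m+kn]%n≡m%n (y * n′ * k) x n ⟨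
    (y * n′ * k + x * n) % n         ≡⟨ cong (λ z → (y * n′ * k + z) % n) eq ⟨
    (y * n′ * k + (G + y * k)) % n   ≡⟨ cong (_% n) (ring y n′ k G) ⟩
    (G + y * k * n) % n              ≡⟨ [m+kn]%n≡m%n G (y * k) n ⟩
    G % n                            ∎)
    where
    open ≡-Reasoning
    ring : ∀ y n′ k G → y * n′ * k + (G + y * k) ≡ G + y * k * suc n′
    ring = solve-∀

  residue-decomposition : ∀ t → ∃[ i ] ∃[ m ] i < G × (i + m * k) % n ≡ t % n
  residue-decomposition t with gcd≡multiple-of-k
  ... | m , mk≡G = t % G , t / G * m , m%n<n t G , (begin
    (t % G + t / G * m * k) % n      ≡⟨ cong (λ z → (t % G + z) % n) (*-assoc (t / G) m k) ⟩
    (t % G + t / G * (m * k)) % n    ≡⟨ %-+-cong {t % G} {t % G} {t / G * (m * k)} {t / G * G} refl (%-*-congˡ (t / G) mk≡G) ⟩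
    (t % G + t / G * G) % n          ≡⟨ cong (_% n) (m≡m%n+[m/n]*n t G) ⟨
    t % n                            ∎)
    where open ≡-Reasoning

  residue-unique : ∀ {a b} m → a < G → b < G → (b + m * k) % n ≡ a % n → b ≡ a
  residue-unique {a} {b} m a<G b<G e = begin
    b                      ≡⟨ m<n⇒m%n≡m b<G ⟨
    b % G                  ≡⟨ %-remove-+ʳ b (∣-trans (gcd[m,n]∣n n k) (n∣m*n m)) ⟨
    (b + m * k) % G        ≡⟨ m∣n⇒o%n%m≡o%m G n (b + m * k) (gcd[m,n]∣m n k) ⟨
    (b + m * k) % n % G    ≡⟨ cong (_% G) e ⟩
    a % n % G              ≡⟨ m∣n⇒o%n%m≡o%m G n a (gcd[m,n]∣m n k) ⟩
    a % G                  ≡⟨ m<n⇒m%n≡m a<G ⟩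
    a                      ∎
    where open ≡-Reasoning

module IteratedRiwi {n′ k} {χ : Code (suc n′) → Code (suc n′)} (R : IsRiwi (suc n′) k χ) where

  open IsRiwi R

  private
    n = suc n′

  iter-χ-preserves-InF′ : ∀ i f → InF′ n k f → InF′ n k (iter i χ f)
  iter-χ-preserves-InF′ = iter-preserves (InF′ n k) χ maps-into

  iter-χ-injective : ∀ i f g → InF′ n k f → InF′ n k g → iter i χ f ≡ iter i χ g → f ≡ g
  iter-χ-injective = iter-injectiveOn (InF′ n k) χ maps-into injective

  iter-χ-surjective : ∀ i g → InF′ n k g → ∃[ f ] (InF′ n k f × iter i χ f ≡ g)
  iter-χ-surjective = iter-surjectiveOn (InF′ n k) χ surjective

  iter-χ-iter-rot : ∀ i m f → InF′ n k f → iter i χ (iter m rot f) ≡ iter m rot (iter i χ f)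
  iter-χ-iter-rot = iter-commutesOn (InF′ n k) χ rot maps-into rot-preserves-InF′ commutes

  wsum-χ : ∀ f → InF′ n k f → wsum (χ f) % n ≡ suc (wsum f) % n
  wsum-χ f f∈F′ = proj₂ (shifts-t (wsum f) f (f∈F′ , refl))

  wsum-iter-χ : ∀ i f → InF′ n k f → wsum (iter i χ f) % n ≡ (i + wsum f) % n
  wsum-iter-χ zero    f _    = refl
  wsum-iter-χ (suc i) f f∈F′ =
    trans (wsum-χ _ (iter-χ-preserves-InF′ i f f∈F′))
          (%-+-cong {1} {1} {wsum (iter i χ f)} {i + wsum f} refl (wsum-iter-χ i f f∈F′))

module NecklaceMap
  (n′ k : ℕ) (χ : Code (suc n′) → Code (suc n′)) (R : IsRiwi (suc n′) k χ)
  (q : ℕ) (q*G≡n : q * gcd (suc n′) k ≡ suc n′)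
  (rep : Code (suc n′) → Code (suc n′)) (RC : IsRepChoice (suc n′) k q rep)
  (σ : Code (suc n′) → Word) (σ-spec : IsSigma (suc n′) k q χ rep σ) where

  open GcdArithmetic n′ k
  open IteratedRiwi R
  open IsRepChoice RC

  private
    n = suc n′
    G = gcd n k
    F₀ = InF′t n k 0

  iter-rot-*q-preserves-F₀ : ∀ j r → F₀ r → F₀ (iter (j * q) rot r)
  iter-rot-*q-preserves-F₀ j r (r∈F′ , wr) = iter-rot-preserves-InF′ (j * q) r r∈F′ , (begin
    wsum (iter (j * q) rot r) % n               ≡⟨ %-remove-+ʳ (wsum (iter (j * q) rot r)) n∣j*q*k ⟨
    (wsum (iter (j * q) rot r) + j * q * k) % n ≡⟨ wsum-iter-rot (j * q) r (proj₁ r∈F′) ⟩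
    wsum r % n                                  ≡⟨ wr ⟩
    0                                           ∎)
    where
    open ≡-Reasoning
    n∣j*q*k : n ∣ j * q * k
    n∣j*q*k = subst (n ∣_) (sym (*-assoc j q k)) (∣-trans (n∣q*k q q*G≡n) (n∣m*n j))

  wsum-iter-χ-F₀ : ∀ i r → F₀ r → wsum (iter i χ r) % n ≡ i % n
  wsum-iter-χ-F₀ i r (r∈F′ , wr) =
    trans (wsum-iter-χ i r r∈F′)
          (trans (%-+-cong {i} {i} {wsum r} {0} refl wr) (cong (_% n) (+-identityʳ i)))

  rep-idempotent : ∀ x → F₀ x → rep (rep x) ≡ rep x
  rep-idempotent x x∈F₀ = rep-const (rep x) x (rep-in x x∈F₀) x∈F₀ (rep-class x x∈F₀)

  rep-iter-rot-*q : ∀ j r → F₀ r → rep (iter (j * q) rot r) ≡ rep r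
  rep-iter-rot-*q j r r∈F₀ = sym (rep-const r _ r∈F₀ (iter-rot-*q-preserves-F₀ j r r∈F₀) (j , refl))

  σ-decomposition : ∀ x → F₀ x →
    ∃[ a ] a < G × iter (a * q) rot (rep x) ≡ x × σ x ≡ ν (iter a χ (rep x))
  σ-decomposition x x∈F₀ with rep-class x x∈F₀
  ... | j , e = j % G , m%n<n j G , rotates , σ-spec x (j % G) x∈F₀ (m%n<n j G) rotates
    where
    open ≡-Reasoning
    ring : ∀ a b q G → (a + b * G) * q ≡ a * q + b * (q * G)
    ring = solve-∀
    j*q≡ : j * q ≡ j % G * q + j / G * n
    j*q≡ = begin
      j * q                          ≡⟨ cong (_* q) (m≡m%n+[m/n]*n j G) ⟩
      (j % G + j / G * G) * q        ≡⟨ ring (j % G) (j / G) q G ⟩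
      j % G * q + j / G * (q * G)    ≡⟨ cong (λ m → j % G * q + j / G * m) q*G≡n ⟩
      j % G * q + j / G * n          ∎
    rotates : iter (j % G * q) rot (rep x) ≡ x
    rotates = begin
      iter (j % G * q) rot (rep x)
        ≡⟨ cong (iter (j % G * q) rot) (iter-rot-*n (j / G) (rep x) (proj₁ (rep-in x x∈F₀))) ⟨
      iter (j % G * q) rot (iter (j / G * n) rot (rep x))
        ≡⟨ iter-+ (j % G * q) (j / G * n) rot (rep x) ⟨
      iter (j % G * q + j / G * n) rot (rep x)
        ≡⟨ cong (λ p → iter p rot (rep x)) j*q≡ ⟨
      iter (j * q) rot (rep x)
        ≡⟨ e ⟩
      x ∎

  iter-rot-χ-images⇒ : ∀ {a b r r′} m → a < G → b < G → F₀ r → F₀ r′ →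
    iter m rot (iter a χ r) ≡ iter b χ r′ → a ≡ b × n ∣ m * k
  iter-rot-χ-images⇒ {a} {b} {r} {r′} m a<G b<G r∈F₀ r′∈F₀ em = sym b≡a , n∣m*k
    where
    open ≡-Reasoning
    u = iter a χ r
    b+mk≡a : (b + m * k) % n ≡ a % n
    b+mk≡a = begin
      (b + m * k) % n
        ≡⟨ %-+-cong {wsum (iter b χ r′)} {b} {m * k} {m * k} (wsum-iter-χ-F₀ b r′ r′∈F₀) refl ⟨
      (wsum (iter b χ r′) + m * k) % n  ≡⟨ cong (λ v → (wsum v + m * k) % n) em ⟨
      (wsum (iter m rot u) + m * k) % n ≡⟨ wsum-iter-rot m u (proj₁ (iter-χ-preserves-InF′ a r (proj₁ r∈F₀))) ⟩
      wsum u % n                        ≡⟨ wsum-iter-χ-F₀ a r r∈F₀ ⟩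
      a % n                             ∎
    b≡a : b ≡ a
    b≡a = residue-unique m a<G b<G b+mk≡a
    n∣m*k : n ∣ m * k
    n∣m*k = m%n≡0⇒n∣m (m * k) n (%-+-cancelˡ a
      (trans (subst (λ c → (c + m * k) % n ≡ a % n) b≡a b+mk≡a) (cong (_% n) (sym (+-identityʳ a)))))

  ν-iter-χ-NeckEq⇒ : ∀ {a b r r′} → a < G → b < G → F₀ r → F₀ r′ →
    NeckEq (ν (iter a χ r)) (ν (iter b χ r′)) → a ≡ b × SameNeckClass q r r′
  ν-iter-χ-NeckEq⇒ {a} {r = r} {r′} a<G b<G r∈F₀@(r∈F′ , _) r′∈F₀@(r′∈F′ , _) ne
    with NeckEq-ν⇒iter-rot _ _ ne
  ... | m , em with iter-rot-χ-images⇒ m a<G b<G r∈F₀ r′∈F₀ em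
  ...   | refl , n∣m*k with n∣m*k⇒q∣m q m q*G≡n n∣m*k
  ...     | divides m′ refl = refl , m′ ,
    iter-χ-injective a _ r′ (iter-rot-preserves-InF′ (m′ * q) r r∈F′) r′∈F′
      (trans (iter-χ-iter-rot a (m′ * q) r r∈F′) em)

  σ-into : ∀ x → F₀ x → InN′ n k (σ x)
  σ-into x x∈F₀ with σ-decomposition x x∈F₀
  ... | a , _ , _ , σx≡ =
    iter a χ (rep x) , iter-χ-preserves-InF′ a (rep x) (proj₁ (rep-in x x∈F₀)) , NeckEq-reflexive (sym σx≡)

  σ-injective : ∀ x y → F₀ x → F₀ y → NeckEq (σ x) (σ y) → x ≡ y
  σ-injective x y x∈F₀ y∈F₀ ne
    with σ-decomposition x x∈F₀ | σ-decomposition y y∈F₀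
  ... | a , a<G , rotx , σx≡ | b , b<G , roty , σy≡
    with ν-iter-χ-NeckEq⇒ a<G b<G (rep-in x x∈F₀) (rep-in y y∈F₀) (subst₂ NeckEq σx≡ σy≡ ne)
  ... | refl , same = begin
    x                          ≡⟨ rotx ⟨
    iter (a * q) rot (rep x)   ≡⟨ cong (iter (a * q) rot) repx≡repy ⟩
    iter (a * q) rot (rep y)   ≡⟨ roty ⟩
    y                          ∎
    where
    open ≡-Reasoning
    repx≡repy : rep x ≡ rep y
    repx≡repy = begin
      rep x         ≡⟨ rep-idempotent x x∈F₀ ⟨
      rep (rep x)   ≡⟨ rep-const (rep x) (rep y) (rep-in x x∈F₀) (rep-in y y∈F₀) same ⟩
      rep (rep y)   ≡⟨ rep-idempotent y y∈F₀ ⟩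
      rep y         ∎

  iter-rot-to-small-weight : ∀ g → InF′ n k g → ∃[ i ] ∃[ m ] i < G × wsum (iter m rot g) % n ≡ i % n
  iter-rot-to-small-weight g g∈F′ with residue-decomposition (wsum g)
  ... | i , m , i<G , i+mk≡wg =
    i , m , i<G , %-+-cancelʳ (m * k) {wsum (iter m rot g)} {i} (trans (wsum-iter-rot m g (proj₁ g∈F′)) (sym i+mk≡wg))

  iter-χ-from-F₀ : ∀ i h → InF′ n k h → wsum h % n ≡ i % n → ∃[ y ] (F₀ y × iter i χ y ≡ h)
  iter-χ-from-F₀ i h h∈F′ wh with iter-χ-surjective i h h∈F′
  ... | y , y∈F′ , χⁱy≡h = y , (y∈F′ , %-+-cancelˡ i wy) , χⁱy≡h
    where
    open ≡-Reasoning
    wy : (i + wsum y) % n ≡ (i + 0) % n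
    wy = begin
      (i + wsum y) % n         ≡⟨ wsum-iter-χ i y y∈F′ ⟨
      wsum (iter i χ y) % n    ≡⟨ cong (λ v → wsum v % n) χⁱy≡h ⟩
      wsum h % n               ≡⟨ wh ⟩
      i % n                    ≡⟨ cong (_% n) (+-identityʳ i) ⟨
      (i + 0) % n              ∎

  σ-surjective : ∀ w → InN′ n k w → ∃[ x ] (F₀ x × NeckEq (σ x) w)
  σ-surjective w (g , g∈F′ , νg~w) with iter-rot-to-small-weight g g∈F′
  ... | i , m , i<G , wh with iter-χ-from-F₀ i (iter m rot g) (iter-rot-preserves-InF′ m g g∈F′) wh
  ... | y , y∈F₀ , χⁱy≡h with rep-class y y∈F₀
  ... | j , rotj = x , x∈F₀ , chain
    where
    r = rep y
    r∈F′ = proj₁ (rep-in y y∈F₀)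
    x = iter (i * q) rot r
    x∈F₀ = iter-rot-*q-preserves-F₀ i r (rep-in y y∈F₀)
    repx≡r : rep x ≡ r
    repx≡r = trans (rep-iter-rot-*q i r (rep-in y y∈F₀)) (rep-idempotent y y∈F₀)
    σx≡ : σ x ≡ ν (iter i χ r)
    σx≡ = trans (σ-spec x i x∈F₀ i<G (cong (iter (i * q) rot) repx≡r)) (cong (λ z → ν (iter i χ z)) repx≡r)
    χⁱrotr≡h : iter (j * q) rot (iter i χ r) ≡ iter m rot g
    χⁱrotr≡h = trans (sym (iter-χ-iter-rot i (j * q) r r∈F′)) (trans (cong (iter i χ) rotj) χⁱy≡h)
    chain : NeckEq (σ x) w
    chain = NeckEq-trans (NeckEq-reflexive σx≡)
           (NeckEq-trans (ν-NeckEq-iter-rot (iter i χ r) (j * q))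
           (NeckEq-trans (NeckEq-reflexive (cong ν χⁱrotr≡h))
           (NeckEq-trans (ν-NeckEq-iter-rot⁻¹ m g g∈F′) νg~w)))

theorem3p1 : (n k : ℕ) .{{_ : NonZero n}} → 0 < k →
    (χ : Code n → Code n) → IsRiwi n k χ →
    (q : ℕ) → q * gcd n k ≡ n →
    (rep : Code n → Code n) → IsRepChoice n k q rep →
    (σ : Code n → Word) → IsSigma n k q χ rep σ →
    (∀ x → InF′t n k 0 x → InN′ n k (σ x))
    × (∀ x y → InF′t n k 0 x → InF′t n k 0 y → NeckEq (σ x) (σ y) → x ≡ y)
    × (∀ w → InN′ n k w → ∃[ x ] (InF′t n k 0 x × NeckEq (σ x) w))
theorem3p1 zero k _ χ _ q _ rep _ σ _ =
  (λ x x∈F₀ → ⊥-elim (InF′-zero x (proj₁ x∈F₀))) ,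
  (λ x _ x∈F₀ _ _ → ⊥-elim (InF′-zero x (proj₁ x∈F₀))) ,
  (λ w (g , g∈F′ , _) → ⊥-elim (InF′-zero g g∈F′))
theorem3p1 (suc n′) k _ χ R q q*G≡n rep RC σ σ-spec = σ-into , σ-injective , σ-surjective
  where open NecklaceMap n′ k χ R q q*G≡n rep RC σ σ-spec
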